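{- Let $G$ be a complete wheel with $n\geq9$ vertices, cycle $C=\{c_1,\dots,c_{n-1}\}$ and central vertex $h$. For $L\subseteq C$, let $b_1b_2\cdots b_{n-1}$ be the cyclic binary string with $b_i=1$ iff $c_i\in L$. Call a binary string of length five invalid if it contains at least four zeroes, or it contains exactly three zeroes and is different from $01010$. Then $L$ is an AP-landmark set for parameter $k=2$ if and only if no five cyclically consecutive bits $b_i b_{i+1}b_{i+2}b_{i+3}b_{i+4}$ (indices modulo $n-1$) form an invalid string.
   Context: The complete wheel on $n$ vertices has vertex set $V=C\cup\{h\}$ with $C=\{c_1,\dots,c_{n-1}\}$, edges $\{c_i,h\}$ and $\{c_i,c_{i+1}\}$ for $1\le i\le n-1$, indices modulo $n-1$. $d(x,y)$ denotes graph distance; $\tau$ separates distinct $u,v$ if $d(u,\tau)\neq d(v,\tau)$. $L\subseteq V$ is an AP-landmark set for parameter $k$ if every pair of distinct $u,v\in V$ is separated by at least $k$ distinct vertices of $L$. -}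

module Defs where

open import Data.Nat using (ℕ; zero; suc; _∸_; _≤_; _<_; _<?_; s≤s)
open import Data.Empty using (⊥)
open import Relation.Nullary using (yes; no)
open import Data.Fin using (Fin; toℕ; fromℕ<)
open import Data.Fin.Subset using (Subset; _∈_)
open import Data.Bool using (Bool; true; false)
open import Data.Vec using (Vec; []; _∷_; lookup)
open import Data.List using (List; length)
open import Data.List.Relation.Unary.All using (All)
open import Data.List.Relation.Unary.Unique.Propositional using (Unique)
open import Data.Product using (Σ; ∃; _×_)
open import Data.Sum using (_⊎_)
open import Relation.Binary.PropositionalEquality using (_≡_; _≢_)

-- Vertices of the complete wheel on n = m + 1 vertices:
-- the hub h and cycle vertices c_i, i ∈ Fin m (c_{i+1} is cyc i).
data Vertex (m : ℕ) : Set where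
  hub : Vertex m
  cyc : Fin m → Vertex m

CycNext : {m : ℕ} → Fin m → Fin m → Set
CycNext {m} i j = (toℕ j ≡ suc (toℕ i)) ⊎ ((toℕ i ≡ m ∸ 1) × (toℕ j ≡ 0))

data Adj {m : ℕ} : Vertex m → Vertex m → Set where
  hub-cyc : (i : Fin m) → Adj hub (cyc i)
  cyc-hub : (i : Fin m) → Adj (cyc i) hub
  cyc-fwd : (i j : Fin m) → CycNext i j → Adj (cyc i) (cyc j)
  cyc-bwd : (i j : Fin m) → CycNext i j → Adj (cyc j) (cyc i)

data Walk {m : ℕ} : Vertex m → Vertex m → ℕ → Set where
  nil  : (x : Vertex m) → Walk x x 0
  cons : {x y z : Vertex m} {k : ℕ} → Adj x y → Walk y z k → Walk x z (suc k)

IsDist : {m : ℕ} → Vertex m → Vertex m → ℕ → Set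
IsDist x y k = Walk x y k × (∀ k' → Walk x y k' → k ≤ k')

Separates : {m : ℕ} → Vertex m → Vertex m → Vertex m → Set
Separates τ u v = ∃ λ a → ∃ λ b → IsDist u τ a × IsDist v τ b × a ≢ b

InL : {m : ℕ} → Subset m → Vertex m → Set
InL L hub = ⊥
InL L (cyc i) = i ∈ L

IsAPLandmark : {m : ℕ} → ℕ → Subset m → Set
IsAPLandmark {m} k L =
  (u v : Vertex m) → u ≢ v →
  Σ (List (Vertex m)) λ ts →
    (k ≤ length ts) × Unique ts × All (λ t → InL L t × Separates t u v) ts

csuc : {m : ℕ} → Fin m → Fin m
csuc {suc m} i with toℕ i <? m
... | yes p = fromℕ< (s≤s p)
... | no _ = Fin.zero

cshift : {m : ℕ} → ℕ → Fin m → Fin m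
cshift zero i = i
cshift (suc j) i = csuc (cshift j i)

bit : {m : ℕ} → Subset m → Fin m → Bool
bit L i = lookup L i

window : {m : ℕ} → Subset m → Fin m → Vec Bool 5
window L i = bit L i ∷ bit L (cshift 1 i) ∷ bit L (cshift 2 i)
           ∷ bit L (cshift 3 i) ∷ bit L (cshift 4 i) ∷ []

zeros : {l : ℕ} → Vec Bool l → ℕ
zeros [] = 0
zeros (false ∷ w) = suc (zeros w)
zeros (true ∷ w) = zeros w

Invalid : Vec Bool 5 → Set
Invalid w = (4 ≤ zeros w)
          ⊎ ((zeros w ≡ 3) × (w ≢ (false ∷ true ∷ false ∷ true ∷ false ∷ [])))

module Submission where

-- The wheel has diameter 2: d(h, c) = 1, and two cycle vertices are at distance 0, 1
-- or 2 as they are equal, consecutive, or neither.  We address cycle vertices by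
-- their offset r < m from a base b (c_{b+r} = cshift r b); offsets are a bijection
-- onto the cycle, and the distance of the vertices at offsets r, s is a computable
-- function offsetDist m r s.  For m = 8 + m′ and offsets below 8 it evaluates, so all
-- statements about a single window are decided by computation, as are the two finite
-- facts about 5-bit strings: a valid window has two landmarks among positions
-- {0,1,2,3}, two among {0,1,3,4} and one among {0,1,2}; an invalid one has at most one
-- landmark in {0,1,2,3}, {1,2,3,4} or {0,1,3,4}.  Hence
--  (⇐) every pair u ≠ v is separated by the landmarks of a suitable position set in a
--      window near u (hub pairs, cycle pairs one, two, or at least three steps apart);
--  (⇒) in an invalid window the pair at positions (1,2), (2,3) or (1,3) is separated
--      only by vertices of the matching position set, hence by at most one landmark.

open import Defs
open import Data.Nat using (ℕ; zero; suc; _+_; _∸_; _≤_; _<_; z≤n; s≤s; _<?_; _≤?_; _≟_; _≡ᵇ_; _<ᵇ_)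
open import Data.Nat.Properties
open import Data.Fin using (Fin; toℕ; fromℕ<; #_) renaming (zero to fz; suc to fs)
import Data.Fin as Fin
open import Data.Fin.Properties using (toℕ-fromℕ<; toℕ-injective; toℕ<n; any?; all?)
open import Data.Fin.Subset using (Subset; _∈_; _∉_; _∩_; Nonempty; inside; outside)
open import Data.Fin.Subset.Properties using (_∈?_; nonempty?; x∈p∩q⁺; x∈p∩q⁻)
open import Data.Bool using (Bool; true; false; T; if_then_else_; _∨_)
import Data.Bool as Bool
open import Data.Vec using ([]; _∷_; lookup)
open import Data.Vec.Properties using (≡-dec; lookup⇒[]=; []=⇒lookup)
open import Data.List using (List; []; _∷_; length)
open import Data.List.Relation.Unary.All using (All; []; _∷_)
open import Data.List.Relation.Unary.AllPairs using ([]; _∷_)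
open import Data.List.Relation.Unary.Unique.Propositional using (Unique)
open import Data.Unit using (tt)
open import Data.Empty using (⊥; ⊥-elim)
open import Data.Product using (Σ; ∃; ∃₂; _×_; _,_; proj₁; proj₂)
open import Data.Sum using (_⊎_; inj₁; inj₂)
open import Function using (_∘_)
open import Function.Bundles using (_⇔_; mk⇔; Equivalence)
open import Relation.Nullary using (¬_; yes; no; Dec; ¬?)
open import Relation.Nullary.Decidable using (True; toWitness; from-yes; _×-dec_; _⊎-dec_; _→-dec_)
open import Relation.Binary.PropositionalEquality
open import Relation.Binary.Definitions using (tri<; tri≈; tri>)

toℕ-csuc : ∀ {m} (i : Fin (suc m)) →
  (toℕ i < m × toℕ (csuc i) ≡ suc (toℕ i)) ⊎ (toℕ i ≡ m × csuc i ≡ fz)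
toℕ-csuc {m} i with toℕ i <? m
... | yes i<m = inj₁ (i<m , toℕ-fromℕ< (s≤s i<m))
... | no i≮m  = inj₂ (≤-antisym (≤-pred (toℕ<n i)) (≮⇒≥ i≮m) , refl)

next-csuc : ∀ {m} (i : Fin m) → CycNext i (csuc i)
next-csuc {suc m} i with toℕ-csuc i
... | inj₁ (_ , e)     = inj₁ e
... | inj₂ (last , e)  = inj₂ (last , cong toℕ e)

next⇒csuc : ∀ {m} (i j : Fin m) → CycNext i j → j ≡ csuc i
next⇒csuc {suc m} i j next with toℕ-csuc i | next
... | inj₁ (_ , e)       | inj₁ e′       = toℕ-injective (trans e′ (sym e))
... | inj₁ (i<m , _)     | inj₂ (last , _) = ⊥-elim (<⇒≢ i<m last)
... | inj₂ (last , _)    | inj₁ e′       =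
  ⊥-elim (<⇒≱ (toℕ<n j) (≤-reflexive (trans (cong suc (sym last)) (sym e′))))
... | inj₂ (_ , e)       | inj₂ (_ , e′) = toℕ-injective (trans e′ (sym (cong toℕ e)))

OffsetValue : ∀ {m} → Fin m → ℕ → Fin m → Set
OffsetValue {m} b r x = (toℕ x ≡ toℕ b + r) ⊎ (toℕ x + m ≡ toℕ b + r)

cshift-value : ∀ {m} (b : Fin m) r → r ≤ m → OffsetValue b r (cshift r b)
cshift-value {suc m} b zero    _    = inj₁ (sym (+-identityʳ _))
cshift-value {suc m} b (suc r) r<m
  with cshift-value b r (<⇒≤ r<m) | toℕ-csuc (cshift r b)
... | inj₁ e | inj₁ (_ , c)    = inj₁ (trans c (trans (cong suc e) (sym (+-suc (toℕ b) r))))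
... | inj₁ e | inj₂ (last , c) rewrite c =
  inj₂ (trans (cong suc (trans (sym last) e)) (sym (+-suc (toℕ b) r)))
... | inj₂ e | inj₁ (_ , c)    rewrite c = inj₂ (trans (cong suc e) (sym (+-suc (toℕ b) r)))
... | inj₂ e | inj₂ (last , _) =
  ⊥-elim (<⇒≢ (+-mono-≤-< (≤-pred (toℕ<n b)) r<m) (sym (trans (cong (_+ suc m) (sym last)) e)))

cshift-add : ∀ {m} r s (i : Fin m) → cshift r (cshift s i) ≡ cshift (r + s) i
cshift-add zero    s i = refl
cshift-add (suc r) s i = cong csuc (cshift-add r s i)

cshift-period : ∀ {m} (b : Fin m) → cshift m b ≡ b
cshift-period {m} b with cshift-value b m ≤-refl
... | inj₁ e = ⊥-elim (<⇒≱ (toℕ<n (cshift m b)) (≤-trans (m≤n+m m (toℕ b)) (≤-reflexive (sym e))))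
... | inj₂ e = toℕ-injective (+-cancelʳ-≡ m _ _ e)

cshift-aperiodic : ∀ {m} (b : Fin m) {d} → 0 < d → d < m → cshift d b ≢ b
cshift-aperiodic {m} b {d} 0<d d<m fixed with cshift-value b d (<⇒≤ d<m)
... | inj₁ e = <⇒≢ 0<d (sym (+-cancelˡ-≡ (toℕ b) d 0
                 (trans (sym e) (trans (cong toℕ fixed) (sym (+-identityʳ _))))))
... | inj₂ e = <⇒≢ d<m (sym (+-cancelˡ-≡ (toℕ b) m d
                 (trans (cong (λ x → toℕ x + m) (sym fixed)) e)))

cshift-back : ∀ {m} n k (i : Fin m) → n + k ≡ m → cshift n (cshift k i) ≡ i
cshift-back n k i e = trans (cshift-add n k i) (trans (cong (λ z → cshift z i) e) (cshift-period i))

cshift-distinct : ∀ {m} (b : Fin m) {r s} → r < s → s < m → cshift r b ≢ cshift s b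
cshift-distinct b {r} {s} r<s s<m eq =
  cshift-aperiodic (cshift r b) (m<n⇒0<n∸m r<s) (≤-<-trans (m∸n≤m s r) s<m) returns
  where
  returns : cshift (s ∸ r) (cshift r b) ≡ cshift r b
  returns = trans (cshift-add (s ∸ r) r b)
                  (trans (cong (λ z → cshift z b) (m∸n+n≡m (<⇒≤ r<s))) (sym eq))

cshift-injective : ∀ {m} (b : Fin m) {r s} → r < m → s < m → cshift r b ≡ cshift s b → r ≡ s
cshift-injective b {r} {s} r<m s<m eq with <-cmp r s
... | tri< r<s _ _ = ⊥-elim (cshift-distinct b r<s s<m eq)
... | tri≈ _ r≡s _ = r≡s
... | tri> _ _ s<r = ⊥-elim (cshift-distinct b s<r r<m (sym eq))

offsets-distinct : ∀ {m} (b : Fin m) {r s} → r < m → s < m → r ≢ s → cshift r b ≢ cshift s b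
offsets-distinct b r<m s<m r≢s = r≢s ∘ cshift-injective b r<m s<m

offset-unique : ∀ {m} (b : Fin m) r {x y : Fin m} →
  OffsetValue b r x → OffsetValue b r y → x ≡ y
offset-unique {m} _ _ (inj₁ ex) (inj₁ ey) = toℕ-injective (trans ex (sym ey))
offset-unique {m} _ _ (inj₂ ex) (inj₂ ey) = toℕ-injective (+-cancelʳ-≡ m _ _ (trans ex (sym ey)))
offset-unique {m} _ _ {x} {y} (inj₁ ex) (inj₂ ey) = ⊥-elim (wraps y x (trans ey (sym ex)))
  where
  wraps : ∀ (y x : Fin m) → toℕ y + m ≢ toℕ x
  wraps y x e = <⇒≱ (toℕ<n x) (≤-trans (m≤n+m m (toℕ y)) (≤-reflexive e))
offset-unique {m} _ _ {x} {y} (inj₂ ex) (inj₁ ey) = ⊥-elim (wraps x y (trans ex (sym ey)))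
  where
  wraps : ∀ (x y : Fin m) → toℕ x + m ≢ toℕ y
  wraps x y e = <⇒≱ (toℕ<n y) (≤-trans (m≤n+m m (toℕ x)) (≤-reflexive e))

cshift-surjective : ∀ {m} (b j : Fin m) → ∃ λ r → r < m × cshift r b ≡ j
cshift-surjective {m} b j with toℕ b ≤? toℕ j
... | yes b≤j =
  r , r<m , offset-unique b r (cshift-value b r (<⇒≤ r<m)) (inj₁ (sym (m+[n∸m]≡n b≤j)))
  where
  r : ℕ
  r = toℕ j ∸ toℕ b
  r<m : r < m
  r<m = ≤-<-trans (m∸n≤m (toℕ j) (toℕ b)) (toℕ<n j)
... | no b≰j =
  r , r<m , offset-unique b r (cshift-value b r (<⇒≤ r<m)) (inj₂ (sym (m+[n∸m]≡n b≤j+m)))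
  where
  r : ℕ
  r = (toℕ j + m) ∸ toℕ b
  b≤j+m : toℕ b ≤ toℕ j + m
  b≤j+m = ≤-trans (<⇒≤ (toℕ<n b)) (m≤n+m m (toℕ j))
  r<m : r < m
  r<m = +-cancelˡ-< (toℕ b) _ _
          (subst (_< toℕ b + m) (sym (m+[n∸m]≡n b≤j+m)) (+-monoˡ-< m (≰⇒> b≰j)))

-- The cyclic predecessor: one step after it is the vertex itself.  It is kept opaque so
-- that the m-fold shift defining it is never unfolded during type checking.
opaque
  cpred : ∀ {m} → Fin (suc m) → Fin (suc m)
  cpred {m} i = cshift m i

  cshift-cpred : ∀ {m} k (i : Fin (suc m)) → cshift (suc k) (cpred i) ≡ cshift k i
  cshift-cpred {m} k i = begin
    cshift (suc k) (cshift m i)  ≡⟨ cshift-add (suc k) m i ⟩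
    cshift (suc k + m) i         ≡⟨ cong (λ z → cshift z i) (sym (+-suc k m)) ⟩
    cshift (k + suc m) i         ≡⟨ sym (cshift-add k (suc m) i) ⟩
    cshift k (cshift (suc m) i)  ≡⟨ cong (cshift k) (cshift-period i) ⟩
    cshift k i                   ∎
    where open ≡-Reasoning

offsetSuc : ℕ → ℕ → ℕ
offsetSuc m r = if suc r <ᵇ m then suc r else 0

offsetSuc-cases : ∀ m r → (suc r < m × offsetSuc m r ≡ suc r) ⊎ (¬ suc r < m × offsetSuc m r ≡ 0)
offsetSuc-cases m r with suc r <ᵇ m in lt
... | true  = inj₁ (<ᵇ⇒< (suc r) m (subst T (sym lt) tt) , refl)
... | false = inj₂ ((λ r+1<m → subst T lt (<⇒<ᵇ r+1<m)) , refl)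

offsetSuc<m : ∀ {m r} → r < m → offsetSuc m r < m
offsetSuc<m {m} {r} r<m with offsetSuc-cases m r
... | inj₁ (r+1<m , e) = subst (_< m) (sym e) r+1<m
... | inj₂ (_ , e)     = subst (_< m) (sym e) (≤-<-trans z≤n r<m)

csuc-cshift : ∀ {m} (b : Fin m) {r} → r < m → csuc (cshift r b) ≡ cshift (offsetSuc m r) b
csuc-cshift {m} b {r} r<m with offsetSuc-cases m r
... | inj₁ (_ , e)      = cong (λ z → cshift z b) (sym e)
... | inj₂ (r+1≮m , e) = begin
  cshift (suc r) b  ≡⟨ cong (λ z → cshift z b) (≤-antisym r<m (≮⇒≥ r+1≮m)) ⟩
  cshift m b        ≡⟨ cshift-period b ⟩
  b                 ≡⟨ cong (λ z → cshift z b) (sym e) ⟩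
  cshift (offsetSuc m r) b ∎
  where open ≡-Reasoning

walk-length0 : ∀ {m} {x y : Vertex m} → Walk x y 0 → x ≡ y
walk-length0 (nil _) = refl

walk-length1 : ∀ {m} {x y : Vertex m} → Walk x y 1 → Adj x y
walk-length1 (cons a (nil _)) = a

adj-consecutive : ∀ {m} {i j : Fin m} → Adj (cyc i) (cyc j) → (j ≡ csuc i) ⊎ (i ≡ csuc j)
adj-consecutive (cyc-fwd i j next) = inj₁ (next⇒csuc i j next)
adj-consecutive (cyc-bwd i j next) = inj₂ (next⇒csuc i j next)

walk-nonempty : ∀ {m} {x y : Vertex m} {k} → x ≢ y → Walk x y k → 1 ≤ k
walk-nonempty {k = zero}  x≢y w = ⊥-elim (x≢y (walk-length0 w))
walk-nonempty {k = suc k} x≢y w = s≤s z≤n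

dist-same : ∀ {m} (x : Vertex m) → IsDist x x 0
dist-same x = nil x , λ _ _ → z≤n

dist-hub-cyc : ∀ {m} (t : Fin m) → IsDist hub (cyc t) 1
dist-hub-cyc t = cons (hub-cyc t) (nil _) , λ _ → walk-nonempty λ ()

cyc-injective : ∀ {m} {i j : Fin m} → cyc i ≡ cyc j → i ≡ j
cyc-injective refl = refl

dist-consecutive : ∀ {m} {i j : Fin m} → i ≢ j → (j ≡ csuc i) ⊎ (i ≡ csuc j) →
  IsDist (cyc i) (cyc j) 1
dist-consecutive {i = i} {j} i≢j consecutive =
  cons (edge consecutive) (nil _) , λ _ → walk-nonempty (i≢j ∘ cyc-injective)
  where
  edge : (j ≡ csuc i) ⊎ (i ≡ csuc j) → Adj (cyc i) (cyc j)
  edge (inj₁ refl) = cyc-fwd i j (next-csuc i)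
  edge (inj₂ refl) = cyc-bwd j i (next-csuc j)

dist-distant : ∀ {m} {i j : Fin m} → i ≢ j → j ≢ csuc i → i ≢ csuc j →
  IsDist (cyc i) (cyc j) 2
dist-distant {i = i} {j} i≢j j≢i⁺ i≢j⁺ = cons (cyc-hub i) (cons (hub-cyc j) (nil _)) , atLeast2
  where
  atLeast2 : ∀ k → Walk (cyc i) (cyc j) k → 2 ≤ k
  atLeast2 zero          w = ⊥-elim (i≢j (cyc-injective (walk-length0 w)))
  atLeast2 (suc zero)    w with adj-consecutive (walk-length1 w)
  ... | inj₁ j≡i⁺ = ⊥-elim (j≢i⁺ j≡i⁺)
  ... | inj₂ i≡j⁺ = ⊥-elim (i≢j⁺ i≡j⁺)
  atLeast2 (suc (suc k)) w = s≤s (s≤s z≤n)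

-- Distance between the vertices at offsets r and s, computed from the tests
-- "same offset" and "consecutive offsets".  For m = 8 + m′ and numeral offsets
-- below 8 it evaluates to a numeral.
distCode : Bool → Bool → ℕ
distCode true  _     = 0
distCode false true  = 1
distCode false false = 2

offsetDist : ℕ → ℕ → ℕ → ℕ
offsetDist m r s = distCode (r ≡ᵇ s) ((s ≡ᵇ offsetSuc m r) ∨ (r ≡ᵇ offsetSuc m s))

≡ᵇ-true : ∀ m n → (m ≡ᵇ n) ≡ true → m ≡ n
≡ᵇ-true m n e = ≡ᵇ⇒≡ m n (subst T (sym e) tt)

≡ᵇ-false : ∀ m n → (m ≡ᵇ n) ≡ false → m ≢ n
≡ᵇ-false m n e m≡n = subst T e (≡⇒≡ᵇ m n m≡n)

≢⇒≡ᵇ-false : ∀ {m n} → m ≢ n → (m ≡ᵇ n) ≡ false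
≢⇒≡ᵇ-false {m} {n} m≢n with m ≡ᵇ n in e
... | true  = ⊥-elim (m≢n (≡ᵇ-true m n e))
... | false = refl

offsetSuc⇒csuc : ∀ {m} (b : Fin m) {r s} → r < m → s ≡ offsetSuc m r →
  cshift s b ≡ csuc (cshift r b)
offsetSuc⇒csuc b r<m refl = sym (csuc-cshift b r<m)

csuc⇒offsetSuc : ∀ {m} (b : Fin m) {r s} → r < m → s < m →
  cshift s b ≡ csuc (cshift r b) → s ≡ offsetSuc m r
csuc⇒offsetSuc b r<m s<m e = cshift-injective b s<m (offsetSuc<m r<m) (trans e (csuc-cshift b r<m))

offsetDist-correct : ∀ {m} (b : Fin m) {r s} → r < m → s < m →
  IsDist (cyc (cshift r b)) (cyc (cshift s b)) (offsetDist m r s)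
offsetDist-correct {m} b {r} {s} r<m s<m
  with r ≡ᵇ s in same | s ≡ᵇ offsetSuc m r in forward | r ≡ᵇ offsetSuc m s in backward
... | true  | _     | _     =
  subst (λ z → IsDist (cyc (cshift r b)) (cyc (cshift z b)) 0) (≡ᵇ-true r s same) (dist-same _)
... | false | true  | _     =
  dist-consecutive (offsets-distinct b r<m s<m (≡ᵇ-false r s same))
    (inj₁ (offsetSuc⇒csuc b r<m (≡ᵇ-true s _ forward)))
... | false | false | true  =
  dist-consecutive (offsets-distinct b r<m s<m (≡ᵇ-false r s same))
    (inj₂ (offsetSuc⇒csuc b s<m (≡ᵇ-true r _ backward)))
... | false | false | false =
  dist-distant (offsets-distinct b r<m s<m (≡ᵇ-false r s same))
    (≡ᵇ-false s _ forward ∘ csuc⇒offsetSuc b r<m s<m)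
    (≡ᵇ-false r _ backward ∘ csuc⇒offsetSuc b s<m r<m)

offsetDist-far : ∀ m {r s} → 2 + r ≤ s → 0 < r ⊎ suc s < m →
  offsetDist m r s ≡ 2 × offsetDist m s r ≡ 2
offsetDist-far m {r} {s} r+2≤s notEnds =
  cong₂ distCode (≢⇒≡ᵇ-false r≢s) (cong₂ _∨_ (≢⇒≡ᵇ-false s≢r⁺) (≢⇒≡ᵇ-false r≢s⁺)) ,
  cong₂ distCode (≢⇒≡ᵇ-false (r≢s ∘ sym)) (cong₂ _∨_ (≢⇒≡ᵇ-false r≢s⁺) (≢⇒≡ᵇ-false s≢r⁺))
  where
  r<s : r < s
  r<s = ≤-trans (n≤1+n _) r+2≤s
  r≢s : r ≢ s
  r≢s = <⇒≢ r<s
  s≢r⁺ : s ≢ offsetSuc m r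
  s≢r⁺ e with offsetSuc-cases m r
  ... | inj₁ (_ , e′) = <⇒≢ r+2≤s (sym (trans e e′))
  ... | inj₂ (_ , e′) = <⇒≢ (≤-<-trans z≤n r<s) (sym (trans e e′))
  r≢s⁺ : r ≢ offsetSuc m s
  r≢s⁺ e with offsetSuc-cases m s
  ... | inj₁ (_ , e′) = <⇒≢ (≤-trans r<s (n≤1+n s)) (trans e e′)
  ... | inj₂ (s+1≮m , e′) = notLast notEnds
    where
    notLast : 0 < r ⊎ suc s < m → ⊥
    notLast (inj₁ 0<r)    = <⇒≢ 0<r (sym (trans e e′))
    notLast (inj₂ s+1<m) = s+1≮m s+1<m

dist-unique : ∀ {m} {x y : Vertex m} {a b} → IsDist x y a → IsDist x y b → a ≡ b
dist-unique (wa , minA) (wb , minB) = ≤-antisym (minA _ wb) (minB _ wa)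

separates : ∀ {m} {τ u v : Vertex m} {a b} → IsDist u τ a → IsDist v τ b → a ≢ b → Separates τ u v
separates {a = a} {b} du dv a≢b = a , b , du , dv , a≢b

separates-distances : ∀ {m} {τ u v : Vertex m} {a b} →
  Separates τ u v → IsDist u τ a → IsDist v τ b → a ≢ b
separates-distances (a′ , b′ , du′ , dv′ , a′≢b′) du dv a≡b =
  a′≢b′ (trans (dist-unique du′ du) (trans a≡b (dist-unique dv dv′)))

separates-sym : ∀ {m} {τ u v : Vertex m} → Separates τ u v → Separates τ v u
separates-sym (a , b , du , dv , a≢b) = b , a , dv , du , a≢b ∘ sym

Separator : ∀ {m} → Subset m → Vertex m → Vertex m → Vertex m → Set
Separator L u v t = InL L t × Separates t u v

TwoSeparators : ∀ {m} → Subset m → Vertex m → Vertex m → Set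
TwoSeparators L u v = ∃₂ λ t₁ t₂ → t₁ ≢ t₂ × Separator L u v t₁ × Separator L u v t₂

twoSeparators-sym : ∀ {m} {L : Subset m} {u v} → TwoSeparators L u v → TwoSeparators L v u
twoSeparators-sym (t₁ , t₂ , t₁≢t₂ , (in₁ , sep₁) , (in₂ , sep₂)) =
  t₁ , t₂ , t₁≢t₂ , (in₁ , separates-sym sep₁) , (in₂ , separates-sym sep₂)

landmark2⇔twoSeparators : ∀ {m} (L : Subset m) →
  IsAPLandmark 2 L ⇔ (∀ u v → u ≢ v → TwoSeparators L u v)
landmark2⇔twoSeparators L =
  mk⇔ (λ ap u v u≢v → firstTwo (ap u v u≢v)) (λ two u v u≢v → asList (two u v u≢v))
  where
  SeparatorList : Vertex _ → Vertex _ → Set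
  SeparatorList u v =
    Σ (List (Vertex _)) λ ts → (2 ≤ length ts) × Unique ts × All (Separator L u v) ts
  firstTwo : ∀ {u v} → SeparatorList u v → TwoSeparators L u v
  firstTwo (t₁ ∷ t₂ ∷ _ , _ , (t₁≢t₂ ∷ _) ∷ _ , sep₁ ∷ sep₂ ∷ _) = t₁ , t₂ , t₁≢t₂ , sep₁ , sep₂
  firstTwo (_ ∷ [] , s≤s () , _)
  asList : ∀ {u v} → TwoSeparators L u v → SeparatorList u v
  asList (t₁ , t₂ , t₁≢t₂ , sep₁ , sep₂) =
    t₁ ∷ t₂ ∷ [] , s≤s (s≤s z≤n) , (t₁≢t₂ ∷ []) ∷ [] ∷ [] , sep₁ ∷ sep₂ ∷ []

positions0123 positions1234 positions0134 positions012 positions123 : Subset 5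
positions0123 = inside  ∷ inside  ∷ inside  ∷ inside  ∷ outside ∷ []
positions1234 = outside ∷ inside  ∷ inside  ∷ inside  ∷ inside  ∷ []
positions0134 = inside  ∷ inside  ∷ outside ∷ inside  ∷ inside  ∷ []
positions012  = inside  ∷ inside  ∷ inside  ∷ outside ∷ outside ∷ []
positions123  = outside ∷ inside  ∷ inside  ∷ inside  ∷ outside ∷ []

TwoElements : ∀ {n} → Subset n → Set
TwoElements X = ∃₂ λ p q → p ≢ q × p ∈ X × q ∈ X

AtMostOne : ∀ {n} → Subset n → Set
AtMostOne X = ∀ p q → p ∈ X → q ∈ X → p ≡ q

twoElements? : ∀ {n} (X : Subset n) → Dec (TwoElements X)
twoElements? X = any? λ p → any? λ q → ¬? (p Fin.≟ q) ×-dec (p ∈? X) ×-dec (q ∈? X)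

atMostOne? : ∀ {n} (X : Subset n) → Dec (AtMostOne X)
atMostOne? X = all? λ p → all? λ q → (p ∈? X) →-dec (q ∈? X) →-dec (p Fin.≟ q)

all-strings? : ∀ {n} {P : Subset n → Set} → (∀ w → Dec (P w)) → Dec (∀ w → P w)
all-strings? {zero} P? with P? []
... | yes p  = yes λ { [] → p }
... | no ¬p = no λ all → ¬p (all [])
all-strings? {suc n} P? with all-strings? (P? ∘ (true ∷_)) | all-strings? (P? ∘ (false ∷_))
... | yes ifTrue | yes ifFalse = yes λ { (true ∷ w) → ifTrue w ; (false ∷ w) → ifFalse w }
... | no ¬ifTrue | _           = no λ all → ¬ifTrue (all ∘ (true ∷_))
... | yes _      | no ¬ifFalse = no λ all → ¬ifFalse (all ∘ (false ∷_))

invalid? : ∀ w → Dec (Invalid w)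
invalid? w = (4 ≤? zeros w)
  ⊎-dec ((zeros w ≟ 3) ×-dec ¬? (≡-dec Bool._≟_ w (false ∷ true ∷ false ∷ true ∷ false ∷ [])))

valid-window-landmarks : ∀ w → ¬ Invalid w →
  TwoElements (positions0123 ∩ w) × TwoElements (positions0134 ∩ w) × Nonempty (positions012 ∩ w)
valid-window-landmarks = from-yes (all-strings? λ w → ¬? (invalid? w) →-dec
  (twoElements? (positions0123 ∩ w) ×-dec twoElements? (positions0134 ∩ w)
    ×-dec nonempty? (positions012 ∩ w)))

invalid-window-sparse : ∀ w → Invalid w →
  AtMostOne (positions0123 ∩ w) ⊎ AtMostOne (positions1234 ∩ w) ⊎ AtMostOne (positions0134 ∩ w)
invalid-window-sparse = from-yes (all-strings? λ w → invalid? w →-dec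
  (atMostOne? (positions0123 ∩ w) ⊎-dec atMostOne? (positions1234 ∩ w)
    ⊎-dec atMostOne? (positions0134 ∩ w)))

window-lookup : ∀ {m} (L : Subset m) b (p : Fin 5) →
  lookup (window L b) p ≡ bit L (cshift (toℕ p) b)
window-lookup L b fz                        = refl
window-lookup L b (fs fz)                   = refl
window-lookup L b (fs (fs fz))              = refl
window-lookup L b (fs (fs (fs fz)))         = refl
window-lookup L b (fs (fs (fs (fs fz))))    = refl

window-landmark : ∀ {m} {L : Subset m} {b p} → p ∈ window L b → InL L (cyc (cshift (toℕ p) b))
window-landmark {L = L} {b} {p} p∈w =
  lookup⇒[]= _ L (trans (sym (window-lookup L b p)) ([]=⇒lookup p∈w))

landmark-in-window : ∀ {m} {L : Subset m} {b p} → InL L (cyc (cshift (toℕ p) b)) → p ∈ window L b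
landmark-in-window {L = L} {b} {p} t∈L =
  lookup⇒[]= p (window L b) (trans (window-lookup L b p) ([]=⇒lookup t∈L))

window-or-beyond : ∀ s → (∃ λ (p : Fin 5) → toℕ p ≡ s) ⊎ 5 ≤ s
window-or-beyond s with s <? 5
... | yes s<5 = inj₁ (fromℕ< s<5 , toℕ-fromℕ< s<5)
... | no  s≮5 = inj₂ (≮⇒≥ s≮5)

CloseLandmark : ∀ {m} → Subset m → Fin m → Fin m → Set
CloseLandmark L i j = ∃ λ t → InL L t × (∃ λ d → IsDist (cyc i) t d × d ≤ 1) × IsDist (cyc j) t 2

≤1⇒≢2 : ∀ {d} → d ≤ 1 → d ≢ 2
≤1⇒≢2 (s≤s ()) refl

close-landmarks-separate : ∀ {m} {L : Subset m} {i j} →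
  CloseLandmark L i j → CloseLandmark L j i → TwoSeparators L (cyc i) (cyc j)
close-landmarks-separate {j = j} (t₁ , t₁∈L , (d₁ , iNear , d₁≤1) , jFar)
                                 (t₂ , t₂∈L , (d₂ , jNear , d₂≤1) , iFar) =
  t₁ , t₂ , distinct , (t₁∈L , separates iNear jFar (≤1⇒≢2 d₁≤1))
                     , (t₂∈L , separates iFar jNear (≤1⇒≢2 d₂≤1 ∘ sym))
  where
  distinct : t₁ ≢ t₂
  distinct refl = ≤1⇒≢2 d₂≤1 (dist-unique jNear jFar)

offset-cases : ∀ {M k} → 0 < k → k < M →
  k ≡ 1 ⊎ k ≡ 2 ⊎ suc k ≡ M ⊎ 2 + k ≡ M ⊎ (3 ≤ k × 3 + k ≤ M)
offset-cases {M} {1}                   _ _   = inj₁ refl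
offset-cases {M} {2}                   _ _   = inj₂ (inj₁ refl)
offset-cases {M} {k@(suc (suc (suc _)))} _ k<M with suc k ≟ M | 2 + k ≟ M
... | yes k+1≡M | _         = inj₂ (inj₂ (inj₁ k+1≡M))
... | no  _     | yes k+2≡M = inj₂ (inj₂ (inj₂ (inj₁ k+2≡M)))
... | no  k+1≢M | no k+2≢M  =
  inj₂ (inj₂ (inj₂ (inj₂ (s≤s (s≤s (s≤s z≤n)) , ≤∧≢⇒< (≤∧≢⇒< k<M k+1≢M) k+2≢M))))

-- The wheel whose cycle has length M = 8 + m′, with a candidate landmark set L ⊆ C.
-- Statements about offsets below 8 are decided by evaluating offsetDist.
module Wheel (m′ : ℕ) (L : Subset (8 + m′)) where

  M : ℕ
  M = 8 + m′

  at : Fin M → ℕ → Vertex M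
  at b r = cyc (cshift r b)

  Valid : Set
  Valid = ∀ i → ¬ Invalid (window L i)

  position<M : (p : Fin 5) → toℕ p < M
  position<M p = ≤-trans (toℕ<n p) (m≤m+n 5 (3 + m′))

  inner : ∀ x → {True (x ∈? positions123)} → x ∈ positions123
  inner x {x∈} = toWitness x∈

  at-distinct : ∀ b {p q : Fin 5} → p ≢ q → at b (toℕ p) ≢ at b (toℕ q)
  at-distinct b {p} {q} p≢q =
    offsets-distinct b (position<M p) (position<M q) (p≢q ∘ toℕ-injective) ∘ cyc-injective

  window-separators : ∀ b (S : Subset 5) {u v} →
    (∀ p → p ∈ S → Separates (at b (toℕ p)) u v) →
    TwoElements (S ∩ window L b) → TwoSeparators L u v
  window-separators b S {u} {v} separating (p , q , p≢q , p∈ , q∈) =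
    at b (toℕ p) , at b (toℕ q) , at-distinct b p≢q , separator p∈ , separator q∈
    where
    separator : ∀ {p} → p ∈ S ∩ window L b → Separator L u v (at b (toℕ p))
    separator {p} p∈ = window-landmark (proj₂ p∈S∩w) , separating p (proj₁ p∈S∩w)
      where
      p∈S∩w : p ∈ S × p ∈ window L b
      p∈S∩w = x∈p∩q⁻ S (window L b) p∈

  SeparatedOn : Fin 5 → Fin 5 → Subset 5 → Set
  SeparatedOn x y S = ∀ p → p ∈ S → offsetDist M (toℕ x) (toℕ p) ≢ offsetDist M (toℕ y) (toℕ p)

  separatedOn? : ∀ x y S → Dec (SeparatedOn x y S)
  separatedOn? x y S =
    all? λ p → (p ∈? S) →-dec ¬? (offsetDist M (toℕ x) (toℕ p) ≟ offsetDist M (toℕ y) (toℕ p))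

  window-pair : ∀ b (x y : Fin 5) S → SeparatedOn x y S →
    TwoElements (S ∩ window L b) → TwoSeparators L (at b (toℕ x)) (at b (toℕ y))
  window-pair b x y S separated = window-separators b S λ p p∈S →
    separates (offsetDist-correct b (position<M x) (position<M p))
              (offsetDist-correct b (position<M y) (position<M p)) (separated p p∈S)

  -- c_i and c_{i+1}, positions 1 and 2 of the window at c_{i-1}, are separated by its
  -- positions 0–3.
  consecutive-pair : Valid → ∀ i → TwoSeparators L (cyc i) (cyc (cshift 1 i))
  consecutive-pair valid i =
    subst₂ (TwoSeparators L) (cong cyc (cshift-cpred 0 i)) (cong cyc (cshift-cpred 1 i))
      (window-pair b (# 1) (# 2) positions0123 (from-yes (separatedOn? (# 1) (# 2) positions0123))
        (proj₁ (valid-window-landmarks _ (valid b))))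
    where
    b : Fin M
    b = cpred i

  -- c_i and c_{i+2}, positions 1 and 3 of the window at c_{i-1}, are separated by its
  -- positions 0,1,3,4.
  second-neighbour-pair : Valid → ∀ i → TwoSeparators L (cyc i) (cyc (cshift 2 i))
  second-neighbour-pair valid i =
    subst₂ (TwoSeparators L) (cong cyc (cshift-cpred 0 i)) (cong cyc (cshift-cpred 2 i))
      (window-pair b (# 1) (# 3) positions0134 (from-yes (separatedOn? (# 1) (# 3) positions0134))
        (proj₁ (proj₂ (valid-window-landmarks _ (valid b)))))
    where
    b : Fin M
    b = cpred i

  -- The hub and c_j are separated by positions 0–3 of the window at c_{j+2}: these
  -- vertices are at distance 2 from c_j and at distance 1 from the hub.
  hub-pair : Valid → ∀ j → TwoSeparators L hub (cyc j)
  hub-pair valid j = window-separators b positions0123 separating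
    (proj₁ (valid-window-landmarks _ (valid b)))
    where
    b : Fin M
    b = cshift 2 j
    distant : ∀ p → p ∈ positions0123 → offsetDist M 0 (toℕ p + 2) ≡ 2
    distant = from-yes (all? λ p → (p ∈? positions0123) →-dec (offsetDist M 0 (toℕ p + 2) ≟ 2))
    separating : ∀ p → p ∈ positions0123 → Separates (at b (toℕ p)) hub (cyc j)
    separating p p∈S = separates (dist-hub-cyc _) fromJ λ ()
      where
      fromJ : IsDist (cyc j) (at b (toℕ p)) 2
      fromJ = subst₂ (IsDist (cyc j)) (cong cyc (sym (cshift-add (toℕ p) 2 j))) (distant p p∈S)
        (offsetDist-correct j (s≤s z≤n) (≤-trans (+-monoˡ-≤ 2 (toℕ<n p)) (m≤m+n 7 (1 + m′))))

  -- A landmark among c_{i-1}, c_i, c_{i+1} (window at c_{i-1}, positions 0–2) is close to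
  -- c_i and at distance 2 from every c_{i+q} with 3 ≤ q ≤ M - 3.
  close-landmark : Valid → ∀ i q → 3 ≤ q → 3 + q ≤ M → CloseLandmark L i (cshift q i)
  close-landmark valid i q 3≤q 3+q≤M = landmark (proj₂ (proj₂ (valid-window-landmarks _ (valid b))))
    where
    b : Fin M
    b = cpred i
    nearby : ∀ p → p ∈ positions012 → offsetDist M 1 (toℕ p) ≤ 1 × toℕ p ≤ 2
    nearby = from-yes (all? λ p → (p ∈? positions012) →-dec
      ((offsetDist M 1 (toℕ p) ≤? 1) ×-dec (toℕ p ≤? 2)))
    landmark : Nonempty (positions012 ∩ window L b) → CloseLandmark L i (cshift q i)
    landmark (p , p∈) =
      at b (toℕ p) , window-landmark (proj₂ p∈S∩w) , (_ , fromI , proj₁ near) , fromQ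
      where
      p∈S∩w : p ∈ positions012 × p ∈ window L b
      p∈S∩w = x∈p∩q⁻ positions012 (window L b) p∈
      near : offsetDist M 1 (toℕ p) ≤ 1 × toℕ p ≤ 2
      near = nearby p (proj₁ p∈S∩w)
      fromI : IsDist (cyc i) (at b (toℕ p)) (offsetDist M 1 (toℕ p))
      fromI = subst (λ v → IsDist v (at b (toℕ p)) (offsetDist M 1 (toℕ p)))
        (cong cyc (cshift-cpred 0 i))
        (offsetDist-correct b (s≤s (s≤s z≤n)) (position<M p))
      fromQ : IsDist (cyc (cshift q i)) (at b (toℕ p)) 2
      fromQ = subst₂ (λ v d → IsDist v (at b (toℕ p)) d) (cong cyc (cshift-cpred q i))
        (proj₂ (offsetDist-far M (≤-trans (+-monoʳ-≤ 2 (proj₂ near)) (s≤s 3≤q)) (inj₂ 3+q≤M)))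
        (offsetDist-correct b (≤-trans (n≤1+n _) 3+q≤M) (position<M p))

  far-pair : Valid → ∀ i k → 3 ≤ k → 3 + k ≤ M → TwoSeparators L (cyc i) (cyc (cshift k i))
  far-pair valid i k 3≤k 3+k≤M = close-landmarks-separate
    (close-landmark valid i k 3≤k 3+k≤M)
    (subst (CloseLandmark L j) (cshift-back (M ∸ k) k i (m∸n+n≡m k≤M))
      (close-landmark valid j (M ∸ k) (m+n≤o⇒m≤o∸n 3 3+k≤M) back≤M))
    where
    j : Fin M
    j = cshift k i
    k≤M : k ≤ M
    k≤M = ≤-trans (m≤n+m k 3) 3+k≤M
    back≤M : 3 + (M ∸ k) ≤ M
    back≤M = ≤-trans (+-monoˡ-≤ (M ∸ k) 3≤k) (≤-reflexive (m+[n∸m]≡n k≤M))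

  backward : ∀ n k i → n + k ≡ M →
    TwoSeparators L (cyc (cshift k i)) (cyc (cshift n (cshift k i))) →
    TwoSeparators L (cyc i) (cyc (cshift k i))
  backward n k i n+k≡M two = twoSeparators-sym
    (subst (TwoSeparators L (cyc (cshift k i)) ∘ cyc) (cshift-back n k i n+k≡M) two)

  offset-pair : Valid → ∀ i k → 0 < k → k < M → TwoSeparators L (cyc i) (cyc (cshift k i))
  offset-pair valid i k 0<k k<M = byCase (offset-cases 0<k k<M)
    where
    Goal : ℕ → Set
    Goal k = TwoSeparators L (cyc i) (cyc (cshift k i))
    byCase : k ≡ 1 ⊎ k ≡ 2 ⊎ suc k ≡ M ⊎ 2 + k ≡ M ⊎ (3 ≤ k × 3 + k ≤ M) → Goal k
    byCase (inj₁ k≡1) = subst Goal (sym k≡1) (consecutive-pair valid i)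
    byCase (inj₂ (inj₁ k≡2)) = subst Goal (sym k≡2) (second-neighbour-pair valid i)
    byCase (inj₂ (inj₂ (inj₁ k+1≡M))) = backward 1 k i k+1≡M (consecutive-pair valid _)
    byCase (inj₂ (inj₂ (inj₂ (inj₁ k+2≡M)))) = backward 2 k i k+2≡M (second-neighbour-pair valid _)
    byCase (inj₂ (inj₂ (inj₂ (inj₂ (3≤k , 3+k≤M))))) = far-pair valid i k 3≤k 3+k≤M

  cycle-pair : Valid → ∀ i j → i ≢ j → TwoSeparators L (cyc i) (cyc j)
  cycle-pair valid i j i≢j = subst (TwoSeparators L (cyc i) ∘ cyc) k↦j
    (offset-pair valid i k (n≢0⇒n>0 (λ k≡0 → i≢j (subst (λ z → cshift z i ≡ j) k≡0 k↦j))) k<M)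
    where
    offset : ∃ λ k → k < M × cshift k i ≡ j
    offset = cshift-surjective i j
    k : ℕ
    k = proj₁ offset
    k<M : k < M
    k<M = proj₁ (proj₂ offset)
    k↦j : cshift k i ≡ j
    k↦j = proj₂ (proj₂ offset)

  two-separators : Valid → ∀ u v → u ≢ v → TwoSeparators L u v
  two-separators valid hub     hub     u≢v = ⊥-elim (u≢v refl)
  two-separators valid hub     (cyc j) _   = hub-pair valid j
  two-separators valid (cyc i) hub     _   = twoSeparators-sym (hub-pair valid i)
  two-separators valid (cyc i) (cyc j) u≢v = cycle-pair valid i j (u≢v ∘ cong cyc)

  Covers : Fin 5 → Fin 5 → Subset 5 → Set
  Covers x y S = ∀ p → p ∉ S → offsetDist M (toℕ x) (toℕ p) ≡ offsetDist M (toℕ y) (toℕ p)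

  covers? : ∀ x y S → Dec (Covers x y S)
  covers? x y S =
    all? λ p → ¬? (p ∈? S) →-dec (offsetDist M (toℕ x) (toℕ p) ≟ offsetDist M (toℕ y) (toℕ p))

  beyond-window : ∀ x → x ∈ positions123 → ∀ {s} → 5 ≤ s → offsetDist M (toℕ x) s ≡ 2
  beyond-window x x∈ 5≤s =
    proj₁ (offsetDist-far M (≤-trans (proj₂ bounds) 5≤s) (inj₁ (proj₁ bounds)))
    where
    bounds : 0 < toℕ x × 2 + toℕ x ≤ 5
    bounds = from-yes (all? λ x → (x ∈? positions123) →-dec ((0 <? toℕ x) ×-dec (2 + toℕ x ≤? 5)))
      x x∈

  separating-offset : ∀ b {x y} S → x ∈ positions123 → y ∈ positions123 → Covers x y S →
    ∀ {s} → s < M → Separates (at b s) (at b (toℕ x)) (at b (toℕ y)) → ∃ λ p → toℕ p ≡ s × p ∈ S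
  separating-offset b {x} {y} S x∈ y∈ covers {s} s<M separating = locate (window-or-beyond s)
    where
    unequal : offsetDist M (toℕ x) s ≢ offsetDist M (toℕ y) s
    unequal = separates-distances separating
      (offsetDist-correct b (position<M x) s<M) (offsetDist-correct b (position<M y) s<M)
    inS : ∀ p → toℕ p ≡ s → Dec (p ∈ S) → p ∈ S
    inS p p≡s (yes p∈S) = p∈S
    inS p refl (no p∉S) = ⊥-elim (unequal (covers p p∉S))
    locate : (∃ λ (p : Fin 5) → toℕ p ≡ s) ⊎ 5 ≤ s → ∃ λ p → toℕ p ≡ s × p ∈ S
    locate (inj₁ (p , p≡s)) = p , p≡s , inS p p≡s (p ∈? S)
    locate (inj₂ 5≤s) =
      ⊥-elim (unequal (trans (beyond-window x x∈ 5≤s) (sym (beyond-window y y∈ 5≤s))))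

  separator-position : ∀ b {x y} S → x ∈ positions123 → y ∈ positions123 → Covers x y S →
    ∀ t → Separator L (at b (toℕ x)) (at b (toℕ y)) t →
    ∃ λ p → t ≡ at b (toℕ p) × p ∈ S ∩ window L b
  separator-position b S x∈ y∈ covers hub     (() , _)
  separator-position b {x} {y} S x∈ y∈ covers (cyc t) (t∈L , separating) = locate (cshift-surjective b t)
    where
    locate : (∃ λ s → s < M × cshift s b ≡ t) → ∃ λ p → cyc t ≡ at b (toℕ p) × p ∈ S ∩ window L b
    locate (s , s<M , s↦t) =
      p , cong cyc t≡p , x∈p∩q⁺ (p∈S , landmark-in-window (subst (InL L ∘ cyc) t≡p t∈L))
      where
      position : ∃ λ p → toℕ p ≡ s × p ∈ S
      position = separating-offset b S x∈ y∈ covers s<M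
        (subst (λ v → Separates (cyc v) (at b (toℕ x)) (at b (toℕ y))) (sym s↦t) separating)
      p : Fin 5
      p = proj₁ position
      p∈S : p ∈ S
      p∈S = proj₂ (proj₂ position)
      t≡p : t ≡ cshift (toℕ p) b
      t≡p = trans (sym s↦t) (cong (λ z → cshift z b) (sym (proj₁ (proj₂ position))))

  sparse-window-unresolved : ∀ b {x y} S → x ∈ positions123 → y ∈ positions123 → Covers x y S →
    AtMostOne (S ∩ window L b) → ¬ TwoSeparators L (at b (toℕ x)) (at b (toℕ y))
  sparse-window-unresolved b S x∈ y∈ covers sparse (t₁ , t₂ , t₁≢t₂ , sep₁ , sep₂) =
    same (separator-position b S x∈ y∈ covers t₁ sep₁) (separator-position b S x∈ y∈ covers t₂ sep₂)
    where
    Located : Vertex M → Set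
    Located t = ∃ λ p → t ≡ at b (toℕ p) × p ∈ S ∩ window L b
    same : Located t₁ → Located t₂ → ⊥
    same (p , t₁≡p , p∈) (q , t₂≡q , q∈) =
      t₁≢t₂ (trans t₁≡p (trans (cong (λ r → at b (toℕ r)) (sparse p q p∈ q∈)) (sym t₂≡q)))

  -- (⇒) If every pair has two separators, no window is invalid: an invalid window leaves
  -- the pair at positions (1,2), (2,3) or (1,3) with at most one separator.
  valid-windows : (∀ u v → u ≢ v → TwoSeparators L u v) → Valid
  valid-windows two b invalid = unresolved (invalid-window-sparse (window L b) invalid)
    where
    unresolved : AtMostOne (positions0123 ∩ window L b) ⊎ AtMostOne (positions1234 ∩ window L b)
               ⊎ AtMostOne (positions0134 ∩ window L b) → ⊥
    unresolved (inj₁ sparse) =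
      sparse-window-unresolved b positions0123 (inner (# 1)) (inner (# 2))
        (from-yes (covers? (# 1) (# 2) positions0123)) sparse
        (two _ _ (at-distinct b {# 1} {# 2} λ ()))
    unresolved (inj₂ (inj₁ sparse)) =
      sparse-window-unresolved b positions1234 (inner (# 2)) (inner (# 3))
        (from-yes (covers? (# 2) (# 3) positions1234)) sparse
        (two _ _ (at-distinct b {# 2} {# 3} λ ()))
    unresolved (inj₂ (inj₂ sparse)) =
      sparse-window-unresolved b positions0134 (inner (# 1)) (inner (# 3))
        (from-yes (covers? (# 1) (# 3) positions0134)) sparse
        (two _ _ (at-distinct b {# 1} {# 3} λ ()))

mainTheorem19 : (m : ℕ) → 8 ≤ m → (L : Subset m) →
    IsAPLandmark 2 L ⇔ (∀ (i : Fin m) → ¬ Invalid (window L i))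
-- Writing m = 8 + m′, both directions pass through TwoSeparators.
mainTheorem19 m 8≤m L with m ∸ 8 | m+[n∸m]≡n 8≤m
... | m′ | refl =
  mk⇔ (valid-windows ∘ Equivalence.to equiv) (Equivalence.from equiv ∘ two-separators)
  where
  open Wheel m′ L
  equiv : IsAPLandmark 2 L ⇔ (∀ u v → u ≢ v → TwoSeparators L u v)
  equiv = landmark2⇔twoSeparators L
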